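{- Let $T$ be a pendant tree of a simple graph $G$ with $|V(T)|>1$. Let $A=\{v_A\}$ be a block of degree $r$ in $T$ whose neighbors $B_1,\dots,B_r$ in $T$ all have degree $2$ in $T$ and satisfy $|B_1|=\dots=|B_r|=1$. For each $i$, let $B_i'\neq A$ be the other neighbor of $B_i$ in $T$, and let $\gamma:=\sum_{1\leq i<j\leq r} d_G(C_{B_i'B_i},C_{B_j'B_j})$. Then $d_G(v_A)\leq r^2-2\gamma$. In particular, $\delta(G)\leq r^2$ and $\lambda(G)<r^2$. Moreover, if $r=2$, then $\kappa(G)\leq 2$.
   Context: $\lambda(G)$ is the edge-connectivity, $\kappa(G)$ the vertex-connectivity. For disjoint vertex sets $X,Y$, $d_G(X,Y)$ is the number of edges with one endpoint in $X$ and the other in $Y$, and $d_G(X):=d_G(X,V\setminus X)$. For vertices $v\neq w$, $\lambda_G(v,w)$ is the minimum of $d_G(X)$ over $X$ containing exactly one of $v,w$. A pair $\{v,w\}$ of distinct vertices is pendant if $\lambda_G(v,w)=\min\{d_G(v),d_G(w)\}$. For a tree $T$ whose vertex set (blocks) is a partition of $V$ and an edge $AB$ of $T$, $C_{AB}$ is the union of blocks in the component of $T-AB$ containing $A$, and $c(AB):=d_G(C_{AB})$. A pendant tree of $G$ is such a tree with: (i) every two distinct vertices in a common block form a pendant pair; (ii) for every edge $AB$ there are $a\in A$, $b\in B$ with $\{a,b\}$ non-pendant; (iii) for every edge $AB$ there are $a^*\in A$, $b^*\in B$ with $c(AB)=\lambda_G(a^*,b^*)$. -}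

module Defs where

open import Data.Nat using (ℕ; zero; suc; _+_; _*_; _≤_; _<_; _⊓_; _<ᵇ_)
open import Data.Fin using (Fin; zero; suc; toℕ; _≟_)
open import Data.Bool using (Bool; true; false; _∧_; _∨_; not; if_then_else_)
open import Data.Product using (Σ; ∃; ∃-syntax; _×_; _,_)
open import Data.Sum using (_⊎_)
open import Relation.Nullary using (¬_)
open import Relation.Nullary.Decidable using (⌊_⌋)
open import Relation.Binary.PropositionalEquality using (_≡_; _≢_)

sumF : ∀ {n} → (Fin n → ℕ) → ℕ
sumF {zero}  f = 0
sumF {suc n} f = f zero + sumF (λ i → f (suc i))

[_] : Bool → ℕ
[ b ] = if b then 1 else 0

Subset : ℕ → Set
Subset n = Fin n → Bool

card : ∀ {n} → Subset n → ℕ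
card S = sumF (λ v → [ S v ])

eqB : ∀ {n} → Fin n → Fin n → Bool
eqB x y = ⌊ x ≟ y ⌋

record Graph : Set where
  field
    n     : ℕ
    adj   : Fin n → Fin n → Bool
    sym   : ∀ x y → adj x y ≡ adj y x
    irrefl : ∀ x → adj x x ≡ false

module _ (G : Graph) where
  open Graph G

  -- d_G(X,Y): number of edges with one end in X, the other in Y (X, Y disjoint)
  dd : Subset n → Subset n → ℕ
  dd X Y = sumF (λ x → sumF (λ y → [ X x ∧ Y y ∧ adj x y ]))

  d : Subset n → ℕ
  d X = dd X (λ v → not (X v))

  deg : Fin n → ℕ
  deg v = d (eqB v)

  Separates : Subset n → Fin n → Fin n → Set
  Separates X v w = X v ≢ X w

  IsLocalEdgeConn : Fin n → Fin n → ℕ → Set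
  IsLocalEdgeConn v w k =
    (∃[ X ] (Separates X v w × d X ≡ k)) × (∀ X → Separates X v w → k ≤ d X)

  Pendant : Fin n → Fin n → Set
  Pendant v w = v ≢ w × IsLocalEdgeConn v w (deg v ⊓ deg w)

  IsMinDegree : ℕ → Set
  IsMinDegree k = (∃[ v ] deg v ≡ k) × (∀ v → k ≤ deg v)

  Proper : Subset n → Set
  Proper X = (∃[ v ] X v ≡ true) × (∃[ w ] X w ≡ false)

  IsEdgeConn : ℕ → Set
  IsEdgeConn k = (∃[ X ] (Proper X × d X ≡ k)) × (∀ X → Proper X → k ≤ d X)

  -- G - S is disconnected or has at most one vertex
  IsVertexCut : Subset n → Set
  IsVertexCut S =
    card {n} (λ v → not (S v)) ≤ 1
    ⊎ Σ (Subset n) λ X → ( (∀ v → X v ≡ true → S v ≡ false)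
             × (∃[ v ] (X v ≡ true))
             × (∃[ w ] (S w ≡ false × X w ≡ false))
             × (∀ x y → X x ≡ true → S y ≡ false → X y ≡ false → adj x y ≡ false))

  IsVertexConn : ℕ → Set
  IsVertexConn k =
    (∃[ S ] (IsVertexCut S × card S ≡ k)) × (∀ S → IsVertexCut S → k ≤ card S)

anyF : ∀ {m} → (Fin m → Bool) → Bool
anyF {zero}  f = false
anyF {suc m} f = f zero ∨ anyF (λ i → f (suc i))

reachIn : ∀ {m} → (Fin m → Fin m → Bool) → Fin m → ℕ → Fin m → Bool
reachIn E a zero    x = eqB a x
reachIn E a (suc k) x = reachIn E a k x ∨ anyF (λ y → reachIn E a k y ∧ E y x)

-- x lies in the connected component of a (walks of length ≤ m suffice)
reach : ∀ {m} → (Fin m → Fin m → Bool) → Fin m → Fin m → Bool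
reach {m} E a x = reachIn E a m x

removeEdge : ∀ {m} → (Fin m → Fin m → Bool) → Fin m → Fin m → Fin m → Fin m → Bool
removeEdge E a b x y = E x y ∧ not ((eqB x a ∧ eqB y b) ∨ (eqB x b ∧ eqB y a))

degB : ∀ {m} → (Fin m → Fin m → Bool) → Fin m → ℕ
degB E x = sumF (λ y → [ E x y ])

record IsTree {m : ℕ} (E : Fin m → Fin m → Bool) : Set where
  field
    symT       : ∀ x y → E x y ≡ E y x
    irreflT    : ∀ x → E x x ≡ false
    connected  : ∀ x y → reach E x y ≡ true
    bridges    : ∀ x y → E x y ≡ true → reach (removeEdge E x y) x y ≡ false

-- Tree T whose nodes (blocks) Fin m form a partition of V(G) = Fin n via
-- the block map β : Fin n → Fin m (v lies in block β v).

module _ (G : Graph) where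
  open Graph G

  -- C_{AB}: union of blocks in the component of T - AB containing A
  C : ∀ {m} → (Fin n → Fin m) → (Fin m → Fin m → Bool) → Fin m → Fin m → Subset n
  C β E A B v = reach (removeEdge E A B) A (β v)

  c : ∀ {m} → (Fin n → Fin m) → (Fin m → Fin m → Bool) → Fin m → Fin m → ℕ
  c β E A B = d G (C β E A B)

  record IsPendantTree {m : ℕ} (β : Fin n → Fin m) (E : Fin m → Fin m → Bool) : Set where
    field
      tree        : IsTree E
      blocksNonempty : ∀ X → ∃[ v ] β v ≡ X
      pendantInBlock : ∀ v w → v ≢ w → β v ≡ β w → Pendant G v w
      nonPendantAcross : ∀ X Y → E X Y ≡ true →
        ∃[ a ] ∃[ b ] (β a ≡ X × β b ≡ Y × ¬ Pendant G a b)
      cutRealised : ∀ X Y → E X Y ≡ true →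
        ∃[ a ] ∃[ b ] (β a ≡ X × β b ≡ Y × IsLocalEdgeConn G a b (c β E X Y))

  gamma : ∀ {m r} → (Fin n → Fin m) → (Fin m → Fin m → Bool) →
          (B B' : Fin r → Fin m) → ℕ
  gamma β E B B' =
    sumF (λ i → sumF (λ j →
      if toℕ i <ᵇ toℕ j
      then dd G (C β E (B' i) (B i)) (C β E (B' j) (B j))
      else 0))

module Submission where

-- Write a = v_A and let S_i = C_{B_i A} be the side of the spoke B_i = {b_i}.
-- Exploring T from A, every block is A, some B_i, or lies in the branch
-- D_i = C_{B′_i B_i}; the branches are disjoint and S_i = {b_i} ∪ D_i
-- (StarBlocks). So V(G) splits into {a}, the b_i and the D_i, and double
-- counting the edges over this partition (StarCount) gives
--     d(a) + Σ d(b_i) + 2γ ≤ Σ d(D_i) + (r + 1) r.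
-- In a pendant tree a cut next to a singleton block is smaller than its degree
-- (PendantCut): d(D_i) < d(b_i) and d(S_i) < d(a). Hence d(a) + 2γ ≤ r², so
-- δ ≤ r², and λ ≤ d(S_i) < r² (Star). For r = 2 the same counting on the four
-- parts {a}, {b_1}, D_1, S_2 leaves no edge between D_1 and S_2, so {a, b_1}
-- is a vertex cut and κ ≤ 2 (TwoSpokes).

open import Defs
open import Data.Nat using (ℕ; zero; suc; _+_; _*_; _≤_; _<_; z≤n; s≤s; _⊓_; _<ᵇ_; _≤ᵇ_; _≤?_; _<?_)
open import Data.Nat.Properties hiding (_≟_; suc-injective; <-cmp)
open import Algebra.Properties.CommutativeSemigroup +-commutativeSemigroup using (interchange)
open import Data.Fin using (Fin; zero; suc; _≟_; toℕ)
open import Data.Fin.Properties using (suc-injective; <-cmp; all?)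
open import Data.Bool using (Bool; true; false; _∧_; _∨_; not; if_then_else_; T)
import Data.Bool as Bool
open import Data.Bool.Properties using (∧-zeroʳ; ∧-identityʳ; ⇔→≡)
open import Data.Maybe using (Maybe; just; nothing)
open import Data.Product using (∃-syntax; _×_; _,_; proj₁; proj₂; uncurry)
open import Data.Sum using (_⊎_; inj₁; inj₂)
open import Data.Empty using (⊥-elim)
open import Function.Bundles using (mk⇔)
open import Function.Definitions using (Injective)
open import Relation.Binary.Definitions using (tri<; tri≈; tri>)
open import Relation.Nullary using (¬_; yes; no)
open import Relation.Nullary.Decidable using (_×-dec_; from-yes)
open import Relation.Binary.PropositionalEquality hiding ([_])

∨-true : ∀ a {b} → a ∨ b ≡ true → a ≡ true ⊎ b ≡ true
∨-true true  _ = inj₁ refl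
∨-true false p = inj₂ p

∨-introˡ : ∀ {a} b → a ≡ true → a ∨ b ≡ true
∨-introˡ b refl = refl

∨-introʳ : ∀ a {b} → b ≡ true → a ∨ b ≡ true
∨-introʳ true  _ = refl
∨-introʳ false p = p

∧-true : ∀ a {b} → a ∧ b ≡ true → a ≡ true × b ≡ true
∧-true true p = refl , p

false≢true : false ≢ true
false≢true ()

eqB-refl : ∀ {n} (x : Fin n) → eqB x x ≡ true
eqB-refl x with x ≟ x
... | yes _   = refl
... | no x≢x = ⊥-elim (x≢x refl)

eqB-false : ∀ {n} {x y : Fin n} → x ≢ y → eqB x y ≡ false
eqB-false {x = x} {y} x≢y with x ≟ y
... | yes x≡y = ⊥-elim (x≢y x≡y)
... | no _    = refl

eqB-true : ∀ {n} {x y : Fin n} → eqB x y ≡ true → x ≡ y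
eqB-true {x = x} {y} p with x ≟ y
eqB-true p  | yes x≡y = x≡y
eqB-true () | no _

eqB-injective : ∀ {k n} {f : Fin k → Fin n} → Injective _≡_ _≡_ f → ∀ i j → eqB (f i) (f j) ≡ eqB i j
eqB-injective {f = f} inj i j with i ≟ j
... | yes refl = eqB-refl (f i)
... | no i≢j   = eqB-false (λ e → i≢j (inj e))

ind-≤1 : ∀ b → [ b ] ≤ 1
ind-≤1 true  = ≤-refl
ind-≤1 false = z≤n

ind-∨ : ∀ p q → [ p ∨ q ] ≤ [ p ] + [ q ]
ind-∨ true  q = s≤s z≤n
ind-∨ false q = ≤-refl

ind-mono : ∀ {a b} → (a ≡ true → b ≡ true) → [ a ] ≤ [ b ]
ind-mono {true}  a⇒b rewrite a⇒b refl = ≤-refl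
ind-mono {false} _ = z≤n

if-zero : ∀ a → (if a then 0 else 0) ≡ 0
if-zero true  = refl
if-zero false = refl

if-ind : ∀ a b → (if a then [ b ] else 0) ≡ [ a ∧ b ]
if-ind true  b = refl
if-ind false b = refl

if-if : ∀ a b t → (if a then (if b then [ t ] else 0) else 0) ≡ (if t then [ a ∧ b ] else 0)
if-if true  true  t = refl
if-if true  false t = sym (if-zero t)
if-if false b     t = sym (if-zero t)

if-+ : ∀ a x y → (if a then x + y else 0) ≡ (if a then x else 0) + (if a then y else 0)
if-+ true  x y = refl
if-+ false x y = refl

if-mono : ∀ a {x y} → x ≤ y → (if a then x else 0) ≤ (if a then y else 0)
if-mono true  x≤y = x≤y
if-mono false _   = z≤n

evaluated : ∀ {m n} {_ : T (m ≤ᵇ n)} → m ≤ n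
evaluated {m} {n} {m≤n} = ≤ᵇ⇒≤ m n m≤n

<ᵇ-true : ∀ {m n} → m < n → (m <ᵇ n) ≡ true
<ᵇ-true {m} {n} m<n with m <ᵇ n | <⇒<ᵇ m<n
... | true | _ = refl

<ᵇ-false : ∀ {m n} → ¬ m < n → (m <ᵇ n) ≡ false
<ᵇ-false {m} {n} m≮n with m <ᵇ n in eq
... | true  = ⊥-elim (m≮n (<ᵇ⇒< m n (subst T (sym eq) _)))
... | false = refl

sumF-cong : ∀ {n} {f g : Fin n → ℕ} → (∀ i → f i ≡ g i) → sumF f ≡ sumF g
sumF-cong {zero}  _ = refl
sumF-cong {suc n} f≗g = cong₂ _+_ (f≗g zero) (sumF-cong (λ i → f≗g (suc i)))

sumF-mono : ∀ {n} {f g : Fin n → ℕ} → (∀ i → f i ≤ g i) → sumF f ≤ sumF g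
sumF-mono {zero}  _ = z≤n
sumF-mono {suc n} f≤g = +-mono-≤ (f≤g zero) (sumF-mono (λ i → f≤g (suc i)))

sumF-zero : ∀ {n} {f : Fin n → ℕ} → (∀ i → f i ≡ 0) → sumF f ≡ 0
sumF-zero {zero}  _ = refl
sumF-zero {suc n} f≗0 = cong₂ _+_ (f≗0 zero) (sumF-zero (λ i → f≗0 (suc i)))

sumF-+ : ∀ {n} (f g : Fin n → ℕ) → sumF (λ i → f i + g i) ≡ sumF f + sumF g
sumF-+ {zero}  f g = refl
sumF-+ {suc n} f g = trans (cong (f zero + g zero +_) (sumF-+ (λ i → f (suc i)) (λ i → g (suc i))))
                           (interchange (f zero) (g zero) _ _)

sumF-comm : ∀ {n k} (f : Fin n → Fin k → ℕ) →
            sumF (λ i → sumF (λ j → f i j)) ≡ sumF (λ j → sumF (λ i → f i j))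
sumF-comm {zero} {k} f = sym (sumF-zero {k} (λ _ → refl))
sumF-comm {suc n} f = trans (cong (sumF (f zero) +_) (sumF-comm (λ i → f (suc i))))
                            (sym (sumF-+ (f zero) (λ j → sumF (λ i → f (suc i) j))))

sumF-*ʳ : ∀ {n} (f : Fin n → ℕ) k → sumF (λ i → f i * k) ≡ sumF f * k
sumF-*ʳ {zero}  f k = refl
sumF-*ʳ {suc n} f k = trans (cong (f zero * k +_) (sumF-*ʳ (λ i → f (suc i)) k))
                            (sym (*-distribʳ-+ k (f zero) _))

sumF-ones : ∀ n → sumF {n} (λ _ → 1) ≡ n
sumF-ones zero    = refl
sumF-ones (suc n) = cong suc (sumF-ones n)

sumF-if : ∀ {n} a (f : Fin n → ℕ) → (if a then sumF f else 0) ≡ sumF (λ i → if a then f i else 0)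
sumF-if true  f = refl
sumF-if {n} false f = sym (sumF-zero {n} (λ _ → refl))

sumF-point : ∀ {n} (x : Fin n) {f : Fin n → ℕ} → (∀ j → j ≢ x → f j ≡ 0) → sumF f ≡ f x
sumF-point {suc n} zero {f} others = trans (cong (f zero +_) (sumF-zero (λ j → others (suc j) (λ ()))))
                                           (+-identityʳ (f zero))
sumF-point {suc n} (suc x) others =
  cong₂ _+_ (others zero (λ ())) (sumF-point x (λ j j≢x → others (suc j) (λ e → j≢x (suc-injective e))))

sumF-≥ : ∀ {n} (f : Fin n → ℕ) x → f x ≤ sumF f
sumF-≥ f zero    = m≤m+n (f zero) _
sumF-≥ f (suc x) = ≤-trans (sumF-≥ (λ i → f (suc i)) x) (m≤n+m _ (f zero))

sumF-strict : ∀ {n} {f g : Fin n → ℕ} x → (∀ i → f i ≤ g i) → f x < g x → sumF f < sumF g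
sumF-strict zero    f≤g fx<gx = +-mono-<-≤ fx<gx (sumF-mono (λ i → f≤g (suc i)))
sumF-strict (suc x) f≤g fx<gx = +-mono-≤-< (f≤g zero) (sumF-strict x (λ i → f≤g (suc i)) fx<gx)

sumF-≤-length : ∀ {n} {f : Fin n → ℕ} → (∀ i → f i ≤ 1) → sumF f ≤ n
sumF-≤-length {zero}  _ = z≤n
sumF-≤-length {suc n} f≤1 = +-mono-≤ (f≤1 zero) (sumF-≤-length (λ i → f≤1 (suc i)))

count-point : ∀ {n} (x : Fin n) → sumF (λ j → [ eqB x j ]) ≡ 1
count-point x = trans (sumF-point x (λ j j≢x → cong [_] (eqB-false (λ x≡j → j≢x (sym x≡j)))))
                      (cong [_] (eqB-refl x))

count-three : ∀ {n} (f : Fin n → Bool) {x y z} → x ≢ y → x ≢ z → y ≢ z →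
              f x ≡ true → f y ≡ true → f z ≡ true → 3 ≤ sumF (λ j → [ f j ])
count-three f {x} {y} {z} x≢y x≢z y≢z fx fy fz =
  subst (_≤ sumF (λ j → [ f j ])) three-points (sumF-mono at-most-one)
  where
  three-points : sumF (λ j → [ eqB x j ] + ([ eqB y j ] + [ eqB z j ])) ≡ 3
  three-points = trans (sumF-+ (λ j → [ eqB x j ]) (λ j → [ eqB y j ] + [ eqB z j ]))
    (cong₂ _+_ (count-point x) (trans (sumF-+ (λ j → [ eqB y j ]) (λ j → [ eqB z j ]))
                                      (cong₂ _+_ (count-point y) (count-point z))))
  at-most-one : ∀ j → [ eqB x j ] + ([ eqB y j ] + [ eqB z j ]) ≤ [ f j ]
  at-most-one j with x ≟ j | y ≟ j | z ≟ j
  ... | yes refl | yes refl | _        = ⊥-elim (x≢y refl)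
  ... | yes refl | _        | yes refl = ⊥-elim (x≢z refl)
  ... | _        | yes refl | yes refl = ⊥-elim (y≢z refl)
  ... | yes refl | no _     | no _     = ≤-reflexive (cong [_] (sym fx))
  ... | no _     | yes refl | no _     = ≤-reflexive (cong [_] (sym fy))
  ... | no _     | no _     | yes refl = ≤-reflexive (cong [_] (sym fz))
  ... | no _     | no _     | no _     = z≤n

anyF-true : ∀ {m} (f : Fin m → Bool) → anyF f ≡ true → ∃[ x ] f x ≡ true
anyF-true {suc m} f p with ∨-true (f zero) p
... | inj₁ f0 = zero , f0
... | inj₂ fs with anyF-true (λ i → f (suc i)) fs
...   | x , fx = suc x , fx

anyF-intro : ∀ {m} (f : Fin m → Bool) x → f x ≡ true → anyF f ≡ true
anyF-intro f zero    fx = ∨-introˡ _ fx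
anyF-intro f (suc x) fx = ∨-introʳ (f zero) (anyF-intro (λ i → f (suc i)) x fx)

anyF-false : ∀ {m} (f : Fin m → Bool) → anyF f ≡ false → ∀ x → f x ≡ false
anyF-false f none x with f x in fx
... | false = refl
... | true  = ⊥-elim (false≢true (trans (sym none) (anyF-intro f x fx)))

anyF-cong : ∀ {m} {f g : Fin m → Bool} → (∀ x → f x ≡ g x) → anyF f ≡ anyF g
anyF-cong {zero}  _ = refl
anyF-cong {suc m} f≗g = cong₂ _∨_ (f≗g zero) (anyF-cong (λ i → f≗g (suc i)))

-- Walks of any length in a graph on the blocks, as an inductive family; they
-- are easier to reason about than the bounded reachability of Defs.
data Walk {m : ℕ} (E : Fin m → Fin m → Bool) (s : Fin m) : Fin m → Set where
  here : Walk E s s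
  step : ∀ {y x} → Walk E s y → E y x ≡ true → Walk E s x

walk-++ : ∀ {m} {E : Fin m → Fin m → Bool} {s t u} → Walk E s t → Walk E t u → Walk E s u
walk-++ w here        = w
walk-++ w (step w′ e) = step (walk-++ w w′) e

walk-map : ∀ {m} {E E′ : Fin m → Fin m → Bool} {s t} →
           (∀ {u x} → Walk E s u → E u x ≡ true → E′ u x ≡ true) → Walk E s t → Walk E′ s t
walk-map keep here       = here
walk-map keep (step w e) = step (walk-map keep w) (keep w e)

-- `reach` (walks of length at most m) agrees with the existence of a walk:
-- the sets R k reached in at most k steps grow strictly until they
-- stabilise, and they cannot grow m times, so R m is closed under steps.
module Reachability {m : ℕ} {E : Fin m → Fin m → Bool} {s : Fin m} where

  private
    R : ℕ → Fin m → Bool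
    R = reachIn E s

  reachIn⇒walk : ∀ k x → R k x ≡ true → Walk E s x
  reachIn⇒walk zero x p with eqB-true p
  ... | refl = here
  reachIn⇒walk (suc k) x p with ∨-true (R k x) p
  ... | inj₁ q = reachIn⇒walk k x q
  ... | inj₂ q with anyF-true (λ y → R k y ∧ E y x) q
  ...   | y , r with ∧-true (R k y) r
  ...     | ry , e = step (reachIn⇒walk k y ry) e

  reachIn-refl : ∀ k → R k s ≡ true
  reachIn-refl zero    = eqB-refl s
  reachIn-refl (suc k) = ∨-introˡ _ (reachIn-refl k)

  reachIn-suc : ∀ k x → R k x ≡ true → R (suc k) x ≡ true
  reachIn-suc k x p = ∨-introˡ _ p

  reachIn-step : ∀ k {y x} → R k y ≡ true → E y x ≡ true → R (suc k) x ≡ true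
  reachIn-step k {y} {x} ry e =
    ∨-introʳ (R k x) (anyF-intro (λ z → R k z ∧ E z x) y (cong₂ _∧_ ry e))

  Stable : ℕ → Set
  Stable k = ∀ x → R (suc k) x ≡ R k x

  stable-suc : ∀ k → Stable k → Stable (suc k)
  stable-suc k st x = cong₂ _∨_ (st x) (anyF-cong (λ y → cong (_∧ E y x) (st y)))

  size : ℕ → ℕ
  size k = sumF (λ x → [ R k x ])

  new : ℕ → Fin m → Bool
  new k x = R (suc k) x ∧ not (R k x)

  new-grows : ∀ a b → b ∧ not a ≡ true → [ a ] < [ b ]
  new-grows false true _ = s≤s z≤n

  nothing-new : ∀ a b → (a ≡ true → b ≡ true) → b ∧ not a ≡ false → b ≡ a
  nothing-new true  b a⇒b _ = a⇒b refl
  nothing-new false b _   p = trans (sym (∧-identityʳ b)) p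

  grows-or-stable : ∀ k → suc k ≤ size k ⊎ Stable k
  grows-or-stable zero = inj₁ (≤-trans (≤-reflexive (cong [_] (sym (reachIn-refl 0)))) (sumF-≥ _ s))
  grows-or-stable (suc k) with grows-or-stable k
  ... | inj₂ st  = inj₂ (stable-suc k st)
  ... | inj₁ big with anyF (new k) in found
  ...   | true  = let (x , newx) = anyF-true (new k) found in
                  inj₁ (≤-trans (s≤s big)
                         (sumF-strict x (λ z → ind-mono (reachIn-suc k z)) (new-grows _ _ newx)))
  ...   | false = inj₂ (stable-suc k (λ x → nothing-new _ _ (reachIn-suc k x) (anyF-false (new k) found x)))

  -- R cannot exceed the m blocks, so it is stable at step m
  stable-at-m : Stable m
  stable-at-m with grows-or-stable m
  ... | inj₂ st  = st
  ... | inj₁ big = ⊥-elim (<-irrefl refl (≤-trans big (sumF-≤-length (λ x → ind-≤1 (R m x)))))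

  walk⇒reach : ∀ {x} → Walk E s x → reach E s x ≡ true
  walk⇒reach here               = reachIn-refl m
  walk⇒reach (step {x = x} w e) = trans (sym (stable-at-m x)) (reachIn-step m (walk⇒reach w) e)

  reach⇒walk : ∀ {x} → reach E s x ≡ true → Walk E s x
  reach⇒walk = reachIn⇒walk m _

  unreachable : ∀ {x} → ¬ Walk E s x → reach E s x ≡ false
  unreachable {x} no-walk with reach E s x in r
  ... | true  = ⊥-elim (no-walk (reach⇒walk r))
  ... | false = refl

open Reachability

module EdgeRemoval {m : ℕ} (E : Fin m → Fin m → Bool) (a b : Fin m) where

  private
    not-both : ∀ {x y u w : Fin m} → ¬ (x ≡ u × y ≡ w) → (eqB x u ∧ eqB y w) ≡ false
    not-both {x} {y} {u} {w} ne with x ≟ u | y ≟ w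
    ... | yes p | yes q = ⊥-elim (ne (p , q))
    ... | yes _ | no _  = refl
    ... | no _  | _     = refl

  kept : ∀ {x y} → E x y ≡ true → ¬ (x ≡ a × y ≡ b) → ¬ (x ≡ b × y ≡ a) → removeEdge E a b x y ≡ true
  kept e ¬ab ¬ba = cong₂ (λ p q → p ∧ not q) e (cong₂ _∨_ (not-both ¬ab) (not-both ¬ba))

  removed : removeEdge E a b a b ≡ false
  removed = trans (cong (λ t → E a b ∧ not (t ∨ (eqB a b ∧ eqB b a))) (cong₂ _∧_ (eqB-refl a) (eqB-refl b)))
                  (∧-zeroʳ (E a b))

  edge-of : ∀ {x y} → removeEdge E a b x y ≡ true → E x y ≡ true
  edge-of {x} p = proj₁ (∧-true (E x _) p)

  edge-cases : ∀ {x y} → E x y ≡ true → (x ≡ a × y ≡ b) ⊎ (x ≡ b × y ≡ a) ⊎ removeEdge E a b x y ≡ true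
  edge-cases {x} {y} e with (x ≟ a) ×-dec (y ≟ b) | (x ≟ b) ×-dec (y ≟ a)
  ... | yes ab | _      = inj₁ ab
  ... | no _   | yes ba = inj₂ (inj₁ ba)
  ... | no ¬ab | no ¬ba = inj₂ (inj₂ (kept e ¬ab ¬ba))

open EdgeRemoval

-- Membership tests and sums over i are expressed
-- through the optional index of a part, so that on a concrete part they
-- compute.
data Part (r : ℕ) : Set where
  hub    : Part r
  spoke  : Fin r → Part r
  branch : Fin r → Part r

spokeIx branchIx : ∀ {r} → Part r → Maybe (Fin r)
spokeIx (spoke i) = just i
spokeIx _         = nothing
branchIx (branch i) = just i
branchIx _          = nothing

hit : ∀ {r} → Fin r → Maybe (Fin r) → Bool
hit i nothing  = false
hit i (just k) = eqB i k

isHub isCore : ∀ {r} → Part r → Bool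
isHub hub = true
isHub _   = false
isCore (branch _) = false
isCore _          = true

isSpoke isBranch : ∀ {r} → Fin r → Part r → Bool
isSpoke  i c = hit i (spokeIx c)
isBranch i c = hit i (branchIx c)

at : ∀ {r} → Maybe (Fin r) → (Fin r → ℕ) → ℕ
at nothing  h = 0
at (just k) h = h k

at-sum : ∀ {r} (mk : Maybe (Fin r)) (h : Fin r → ℕ) → at mk h ≡ sumF (λ i → if hit i mk then h i else 0)
at-sum {r} nothing h = sym (sumF-zero {r} (λ _ → refl))
at-sum (just k) h = sym (trans (sumF-point k (λ j j≢k → cong (λ t → if t then h j else 0) (eqB-false j≢k)))
                               (cong (λ t → if t then h k else 0) (eqB-refl k)))

at-indicator : ∀ {r} (mk : Maybe (Fin r)) (q : Fin r → Bool) → at mk (λ k → [ q k ]) ≡ sumF (λ i → [ hit i mk ∧ q i ])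
at-indicator mk q = trans (at-sum mk (λ k → [ q k ])) (sumF-cong (λ i → if-ind (hit i mk) (q i)))

at-pairs : ∀ {r} (mk ml : Maybe (Fin r)) (t : Fin r → Fin r → Bool) →
  at mk (λ k → at ml (λ l → [ t k l ])) ≡ sumF (λ i → sumF (λ j → if t i j then [ hit i mk ∧ hit j ml ] else 0))
at-pairs mk ml t = begin
  at mk (λ k → at ml (λ l → [ t k l ]))
    ≡⟨ at-sum mk (λ k → at ml (λ l → [ t k l ])) ⟩
  sumF (λ i → if hit i mk then at ml (λ l → [ t i l ]) else 0)
    ≡⟨ sumF-cong (λ i → cong (λ u → if hit i mk then u else 0) (at-sum ml (λ l → [ t i l ]))) ⟩
  sumF (λ i → if hit i mk then sumF (λ j → if hit j ml then [ t i j ] else 0) else 0)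
    ≡⟨ sumF-cong (λ i → sumF-if (hit i mk) (λ j → if hit j ml then [ t i j ] else 0)) ⟩
  sumF (λ i → sumF (λ j → if hit i mk then (if hit j ml then [ t i j ] else 0) else 0))
    ≡⟨ sumF-cong (λ i → sumF-cong (λ j → if-if (hit i mk) (hit j ml) (t i j))) ⟩
  sumF (λ i → sumF (λ j → if t i j then [ hit i mk ∧ hit j ml ] else 0)) ∎
  where open ≡-Reasoning

module StarBlocks {m : ℕ} {E : Fin m → Fin m → Bool} (tree : IsTree E)
    (A : Fin m) {r : ℕ} (B : Fin r → Fin m) (B-inj : Injective _≡_ _≡_ B)
    (A–B : ∀ i → E A (B i) ≡ true) (A-nbrs : ∀ X → E A X ≡ true → ∃[ i ] B i ≡ X)
    (B-deg2 : ∀ i → degB E (B i) ≡ 2)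
    (B′ : Fin r → Fin m) (B–B′ : ∀ i → E (B i) (B′ i) ≡ true) (B′≢A : ∀ i → B′ i ≢ A) where

  open IsTree tree

  edge-sym : ∀ {x y} → E x y ≡ true → E y x ≡ true
  edge-sym {x} {y} e = trans (symT y x) e

  edge-ends : ∀ {x y} → E x y ≡ true → x ≢ y
  edge-ends {x} e refl = false≢true (trans (sym (irreflT x)) e)

  B–A : ∀ i → E (B i) A ≡ true
  B–A i = edge-sym (A–B i)

  B′–B : ∀ i → E (B′ i) (B i) ≡ true
  B′–B i = edge-sym (B–B′ i)

  A≢B : ∀ i → A ≢ B i
  A≢B i = edge-ends (A–B i)

  B-nbrs : ∀ i X → E (B i) X ≡ true → X ≡ A ⊎ X ≡ B′ i
  B-nbrs i X e with X ≟ A | X ≟ B′ i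
  ... | yes X≡A | _      = inj₁ X≡A
  ... | no _    | yes X≡B′ = inj₂ X≡B′
  ... | no X≢A  | no X≢B′  = ⊥-elim (3≰2 (subst (3 ≤_) (B-deg2 i)
          (count-three (E (B i)) (λ A≡B′ → B′≢A i (sym A≡B′)) (λ A≡X → X≢A (sym A≡X))
             (λ B′≡X → X≢B′ (sym B′≡X)) (B–A i) (B–B′ i) e)))
    where 3≰2 : ¬ 3 ≤ 2
          3≰2 (s≤s (s≤s ()))

  T-branch : Fin r → Fin m → Fin m → Bool
  T-branch i = removeEdge E (B′ i) (B i)

  InBranch : Fin r → Fin m → Set
  InBranch i = Walk (T-branch i) (B′ i)

  T-side : Fin r → Fin m → Fin m → Bool
  T-side i = removeEdge E (B i) A

  InSide : Fin r → Fin m → Set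
  InSide i = Walk (T-side i) (B i)

  extend : ∀ i {Z W} → InBranch i Z → E Z W ≡ true →
           ¬ (Z ≡ B′ i × W ≡ B i) → ¬ (Z ≡ B i × W ≡ B′ i) → InBranch i W
  extend i w e ¬ab ¬ba = step w (kept E (B′ i) (B i) e ¬ab ¬ba)

  -- B′_iB_i is a bridge, so B_i is not in D_i; then neither are A and the
  -- other spokes, being joined to B_i by edges other than B′_iB_i
  spoke∉own-branch : ∀ i → ¬ InBranch i (B i)
  spoke∉own-branch i w = false≢true (trans (sym (bridges (B′ i) (B i) (B′–B i))) (walk⇒reach w))

  hub∉branch : ∀ i → ¬ InBranch i A
  hub∉branch i w = spoke∉own-branch i
    (extend i w (A–B i) (λ (A≡B′ , _) → B′≢A i (sym A≡B′)) (λ (A≡B , _) → A≢B i A≡B))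

  spoke∉branch : ∀ i j → ¬ InBranch i (B j)
  spoke∉branch i j w = hub∉branch i
    (extend i w (B–A j) (λ (_ , A≡B) → A≢B i A≡B) (λ (_ , A≡B′) → B′≢A i (sym A≡B′)))

  -- walking back along a walk of D_i never leaves D_j, down to B′_i, whose
  -- neighbour B_i would then lie in D_j
  branches-disjoint : ∀ i j → i ≢ j → ∀ {Z} → InBranch i Z → ¬ InBranch j Z
  branches-disjoint i j i≢j here wj = spoke∉branch j i
    (extend j wj (B′–B i) (λ (_ , Bi≡Bj) → i≢j (B-inj Bi≡Bj))
                          (λ (B′i≡Bj , _) → spoke∉branch i j (subst (InBranch i) B′i≡Bj here)))
  branches-disjoint i j i≢j (step {y} wi e) wj = branches-disjoint i j i≢j wi
    (extend j wj (edge-sym (edge-of E (B′ i) (B i) e))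
       (λ (_ , y≡Bj) → spoke∉branch i j (subst (InBranch i) y≡Bj wi))
       (λ (Z≡Bj , _) → spoke∉branch i j (subst (InBranch i) Z≡Bj (step wi e))))

  data Place (Z : Fin m) : Set where
    at-hub    : Z ≡ A → Place Z
    at-spoke  : ∀ i → B i ≡ Z → Place Z
    in-branch : ∀ i → InBranch i Z → Place Z

  -- a walk from A enters some B_i first, and then D_i or returns to A
  place-walk : ∀ {Z} → Walk E A Z → Place Z
  place-walk here = at-hub refl
  place-walk (step {W} {Z} w e) with place-walk w
  ... | at-hub refl = uncurry at-spoke (A-nbrs Z e)
  ... | at-spoke i refl with B-nbrs i Z e
  ...   | inj₁ Z≡A  = at-hub Z≡A
  ...   | inj₂ refl = in-branch i here
  place-walk (step {W} {Z} w e) | in-branch i wi with edge-cases E (B′ i) (B i) e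
  ... | inj₁ (_ , Z≡B)        = at-spoke i (sym Z≡B)
  ... | inj₂ (inj₁ (_ , Z≡B′)) = in-branch i (subst (InBranch i) (sym Z≡B′) here)
  ... | inj₂ (inj₂ e′)         = in-branch i (step wi e′)

  place : ∀ Z → Place Z
  place Z = place-walk (reach⇒walk (connected A Z))

  part : ∀ {Z} → Place Z → Part r
  part (at-hub _)      = hub
  part (at-spoke i _)  = spoke i
  part (in-branch i _) = branch i

  side⇒ : ∀ i {Z} → InSide i Z → Z ≡ B i ⊎ InBranch i Z
  side⇒ i here = inj₁ refl
  side⇒ i (step {W} {Z} w e) with side⇒ i w
  ... | inj₁ refl with B-nbrs i Z (edge-of E (B i) A e)
  ...   | inj₁ refl = ⊥-elim (false≢true (trans (sym (removed E (B i) A)) e))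
  ...   | inj₂ refl = inj₂ here
  side⇒ i (step {W} {Z} w e) | inj₂ wi with edge-cases E (B′ i) (B i) (edge-of E (B i) A e)
  ... | inj₁ (_ , Z≡B)        = inj₁ Z≡B
  ... | inj₂ (inj₁ (_ , Z≡B′)) = inj₂ (subst (InBranch i) (sym Z≡B′) here)
  ... | inj₂ (inj₂ e′)         = inj₂ (step wi e′)

  side⇐ : ∀ i {Z} → Z ≡ B i ⊎ InBranch i Z → InSide i Z
  side⇐ i (inj₁ refl) = here
  side⇐ i (inj₂ wi)   = walk-++ (step here B→B′) (walk-map avoid-BA wi)
    where
    B→B′ : T-side i (B i) (B′ i) ≡ true
    B→B′ = kept E (B i) A (B–B′ i) (λ (_ , B′≡A) → B′≢A i B′≡A) (λ (B≡A , _) → A≢B i (sym B≡A))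
    avoid-BA : ∀ {u x} → InBranch i u → T-branch i u x ≡ true → T-side i u x ≡ true
    avoid-BA wu e = kept E (B i) A (edge-of E (B′ i) (B i) e)
      (λ (u≡B , _) → spoke∉own-branch i (subst (InBranch i) u≡B wu))
      (λ (u≡A , _) → hub∉branch i (subst (InBranch i) u≡A wu))

  side-reach : ∀ i Z → reach (T-side i) (B i) Z ≡ eqB (B i) Z ∨ reach (T-branch i) (B′ i) Z
  side-reach i Z = ⇔→≡ (mk⇔ to from)
    where
    to : reach (T-side i) (B i) Z ≡ true → eqB (B i) Z ∨ reach (T-branch i) (B′ i) Z ≡ true
    to p with side⇒ i (reach⇒walk p)
    ... | inj₁ refl = ∨-introˡ _ (eqB-refl (B i))
    ... | inj₂ wi   = ∨-introʳ (eqB (B i) Z) (walk⇒reach wi)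
    from : eqB (B i) Z ∨ reach (T-branch i) (B′ i) Z ≡ true → reach (T-side i) (B i) Z ≡ true
    from p with ∨-true (eqB (B i) Z) p
    ... | inj₁ B≡Z = walk⇒reach (side⇐ i (inj₁ (sym (eqB-true B≡Z))))
    ... | inj₂ q   = walk⇒reach (side⇐ i (inj₂ (reach⇒walk q)))

  hub-block : ∀ {Z} (p : Place Z) → eqB A Z ≡ isHub (part p)
  hub-block (at-hub refl)    = eqB-refl A
  hub-block (at-spoke i refl) = eqB-false (A≢B i)
  hub-block (in-branch i w)  = eqB-false (λ A≡Z → hub∉branch i (subst (InBranch i) (sym A≡Z) w))

  spoke-block : ∀ i {Z} (p : Place Z) → eqB (B i) Z ≡ isSpoke i (part p)
  spoke-block i (at-hub refl)     = eqB-false (λ B≡A → A≢B i (sym B≡A))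
  spoke-block i (at-spoke k refl) = eqB-injective B-inj i k
  spoke-block i (in-branch k w)   = eqB-false (λ B≡Z → spoke∉branch k i (subst (InBranch k) (sym B≡Z) w))

  branch-block : ∀ i {Z} (p : Place Z) → reach (T-branch i) (B′ i) Z ≡ isBranch i (part p)
  branch-block i (at-hub refl)     = unreachable (hub∉branch i)
  branch-block i (at-spoke k refl) = unreachable (spoke∉branch i k)
  branch-block i (in-branch k w) with i ≟ k
  ... | yes refl = walk⇒reach w
  ... | no i≢k   = unreachable (branches-disjoint k i (λ k≡i → i≢k (sym k≡i)) w)

  side-block : ∀ i {Z} (p : Place Z) → reach (T-side i) (B i) Z ≡ isSpoke i (part p) ∨ isBranch i (part p)
  side-block i {Z} p = trans (side-reach i Z) (cong₂ _∨_ (spoke-block i p) (branch-block i p))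

-- Every quantity of the lemma is a sum of a weight over
-- the ordered pairs (x, y) of adjacent vertices; inequalities between such
-- sums are proved by comparing the weights on each edge (double counting).
module Counting (G : Graph) where
  open Graph G using (n; adj; irrefl) renaming (sym to adj-sym)

  adjSum : (Fin n → Fin n → ℕ) → ℕ
  adjSum w = sumF (λ x → sumF (λ y → if adj x y then w x y else 0))

  adjSum-cong : ∀ {w w′ : Fin n → Fin n → ℕ} → (∀ x y → w x y ≡ w′ x y) → adjSum w ≡ adjSum w′
  adjSum-cong w≗w′ = sumF-cong (λ x → sumF-cong (λ y → cong (λ t → if adj x y then t else 0) (w≗w′ x y)))

  adjSum-mono : ∀ {w w′ : Fin n → Fin n → ℕ} → (∀ x y → w x y ≤ w′ x y) → adjSum w ≤ adjSum w′
  adjSum-mono w≤w′ = sumF-mono (λ x → sumF-mono (λ y → if-mono (adj x y) (w≤w′ x y)))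

  adjSum-+ : ∀ (w w′ : Fin n → Fin n → ℕ) → adjSum (λ x y → w x y + w′ x y) ≡ adjSum w + adjSum w′
  adjSum-+ w w′ = trans
    (sumF-cong (λ x → trans (sumF-cong (λ y → if-+ (adj x y) (w x y) (w′ x y)))
                            (sumF-+ (λ y → if adj x y then w x y else 0) (λ y → if adj x y then w′ x y else 0))))
    (sumF-+ (λ x → sumF (λ y → if adj x y then w x y else 0)) (λ x → sumF (λ y → if adj x y then w′ x y else 0)))

  adjSum-sum : ∀ {k} (w : Fin k → Fin n → Fin n → ℕ) →
               adjSum (λ x y → sumF (λ i → w i x y)) ≡ sumF (λ i → adjSum (w i))
  adjSum-sum w = trans
    (sumF-cong (λ x → trans (sumF-cong (λ y → sumF-if (adj x y) (λ i → w i x y)))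
                            (sumF-comm (λ y i → if adj x y then w i x y else 0))))
    (sumF-comm (λ x i → sumF (λ y → if adj x y then w i x y else 0)))

  adjSum-if : ∀ a (w : Fin n → Fin n → ℕ) → (if a then adjSum w else 0) ≡ adjSum (λ x y → if a then w x y else 0)
  adjSum-if true  w = refl
  adjSum-if false w = sym (sumF-zero (λ x → sumF-zero (λ y → if-zero (adj x y))))

  adjSum-flip : ∀ (w : Fin n → Fin n → ℕ) → adjSum w ≡ adjSum (λ x y → w y x)
  adjSum-flip w = trans (sumF-comm (λ x y → if adj x y then w x y else 0))
    (sumF-cong (λ x → sumF-cong (λ y → cong (λ a → if a then w y x else 0) (adj-sym y x))))

  double-counting : ∀ (f g : Fin n → Fin n → ℕ) →
                    (∀ x y → f x y + f y x ≤ g x y + g y x) → adjSum f ≤ adjSum g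
  double-counting f g f≤g = *-cancelˡ-≤ 2 (subst₂ _≤_ (twice f) (twice g) (adjSum-mono f≤g))
    where
    twice : ∀ w → adjSum (λ x y → w x y + w y x) ≡ 2 * adjSum w
    twice w = trans (adjSum-+ w (λ x y → w y x))
                    (cong (adjSum w +_) (trans (sym (adjSum-flip w)) (sym (+-identityʳ (adjSum w)))))

  adjSum-shape : ∀ (f g h : Fin n → Fin n → ℕ) →
    adjSum (λ x y → f x y + g x y + (h x y + h x y)) ≡ adjSum f + adjSum g + 2 * adjSum h
  adjSum-shape f g h = trans (adjSum-+ (λ x y → f x y + g x y) (λ x y → h x y + h x y))
    (cong₂ _+_ (adjSum-+ f g) (trans (adjSum-+ h h) (cong (adjSum h +_) (sym (+-identityʳ (adjSum h))))))

  dd-adjSum : ∀ X Y → dd G X Y ≡ adjSum (λ x y → [ X x ∧ Y y ])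
  dd-adjSum X Y = sumF-cong (λ x → sumF-cong (λ y → as-if (X x) (Y y) (adj x y)))
    where
    as-if : ∀ a b c → [ a ∧ b ∧ c ] ≡ (if c then [ a ∧ b ] else 0)
    as-if true  true  c = refl
    as-if true  false c = sym (if-zero c)
    as-if false b     c = sym (if-zero c)

  dd-via : ∀ {X Y s t : Subset n} → (∀ v → X v ≡ s v) → (∀ v → Y v ≡ t v) →
           dd G X Y ≡ adjSum (λ x y → [ s x ∧ t y ])
  dd-via {X} {Y} X≗s Y≗t =
    trans (dd-adjSum X Y) (adjSum-cong (λ x y → cong₂ (λ p q → [ p ∧ q ]) (X≗s x) (Y≗t y)))

  d-via : ∀ {X s : Subset n} → (∀ v → X v ≡ s v) → d G X ≡ adjSum (λ x y → [ s x ∧ not (s y) ])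
  d-via X≗s = dd-via X≗s (λ v → cong not (X≗s v))

  no-edge : ∀ X Y → dd G X Y ≡ 0 → ∀ {x y} → X x ≡ true → Y y ≡ true → adj x y ≡ false
  no-edge X Y none {x} {y} Xx Yy with adj x y in xy
  ... | false = refl
  ... | true  = ⊥-elim (1≰0 (subst₂ _≤_ one none (≤-trans (sumF-≥ _ y) (sumF-≥ _ x))))
    where
    one : [ X x ∧ Y y ∧ adj x y ] ≡ 1
    one = cong₂ (λ p q → [ p ∧ q ]) Xx (cong₂ _∧_ Yy xy)
    1≰0 : ¬ 1 ≤ 0
    1≰0 ()

  dd-singletons : ∀ u w → dd G (eqB u) (eqB w) ≡ [ adj u w ]
  dd-singletons u w = begin
    dd G (eqB u) (eqB w)                         ≡⟨ sumF-point u off-u ⟩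
    sumF (λ y → [ eqB u u ∧ eqB w y ∧ adj u y ]) ≡⟨ sumF-point w off-w ⟩
    [ eqB u u ∧ eqB w w ∧ adj u w ]              ≡⟨ cong₂ (λ p q → [ p ∧ q ∧ adj u w ]) (eqB-refl u) (eqB-refl w) ⟩
    [ adj u w ]                                  ∎
    where
    open ≡-Reasoning
    off-u : ∀ x → x ≢ u → sumF (λ y → [ eqB u x ∧ eqB w y ∧ adj x y ]) ≡ 0
    off-u x x≢u = sumF-zero (λ y → cong (λ t → [ t ∧ eqB w y ∧ adj x y ]) (eqB-false (≢-sym x≢u)))
    off-w : ∀ y → y ≢ w → [ eqB u u ∧ eqB w y ∧ adj u y ] ≡ 0
    off-w y y≢w = trans (cong (λ t → [ eqB u u ∧ t ∧ adj u y ]) (eqB-false (≢-sym y≢w)))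
                        (cong [_] (∧-zeroʳ (eqB u u)))

  inner-pairs : ∀ (K : Subset n) k → card K ≡ suc k → adjSum (λ x y → [ K x ∧ K y ]) ≤ suc k * k
  inner-pairs K k |K| = begin
    adjSum (λ x y → [ K x ∧ K y ]) ≤⟨ sumF-mono row ⟩
    sumF (λ x → [ K x ] * k)        ≡⟨ sumF-*ʳ (λ x → [ K x ]) k ⟩
    card K * k                      ≡⟨ cong (_* k) |K| ⟩
    suc k * k                       ∎
    where
    open ≤-Reasoning
    row : ∀ x → sumF (λ y → if adj x y then [ K x ∧ K y ] else 0) ≤ [ K x ] * k
    row x with K x in Kx
    ... | false = ≤-reflexive (sumF-zero (λ y → if-zero (adj x y)))
    ... | true  = ≤-trans (≤-pred (subst (sumF (λ y → if adj x y then [ K y ] else 0) <_) |K| (sumF-strict x below diagonal)))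
                          (≤-reflexive (sym (*-identityˡ k)))
      where
      below : ∀ y → (if adj x y then [ K y ] else 0) ≤ [ K y ]
      below y with adj x y
      ... | true  = ≤-refl
      ... | false = z≤n
      diagonal : (if adj x x then [ K x ] else 0) < [ K x ]
      diagonal rewrite irrefl x | Kx = s≤s z≤n

pairwiseEdges : (G : Graph) {r : ℕ} → (Fin r → Subset (Graph.n G)) → ℕ
pairwiseEdges G D = sumF (λ i → sumF (λ j → if toℕ i <ᵇ toℕ j then dd G (D i) (D j) else 0))

-- Given the part of each vertex,
-- with a the only hub vertex, b_i the only vertex of spoke i and D_i the
-- vertices of branch i, the edges are counted by weights on pairs of parts.
module StarCount (G : Graph) {r : ℕ} (partOf : Fin (Graph.n G) → Part r)
    (a : Fin (Graph.n G)) (b : Fin r → Fin (Graph.n G)) (D : Fin r → Subset (Graph.n G))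
    (hub-vertex    : ∀ v → eqB a v ≡ isHub (partOf v))
    (spoke-vertex  : ∀ i v → eqB (b i) v ≡ isSpoke i (partOf v))
    (branch-vertex : ∀ i v → D i v ≡ isBranch i (partOf v)) where

  open Graph G using (n; adj)
  open Counting G

  -- an edge leaving the hub, leaving spoke k, leaving branch k; going from
  -- branch k to branch l with k < l; inside the core {a, b_1, …, b_r}
  hubOut spokeOut branchOut branchPairs core lhs rhs : Part r → Part r → ℕ
  hubOut      c c′ = [ isHub c ∧ not (isHub c′) ]
  spokeOut    c c′ = at (spokeIx c) (λ k → [ not (isSpoke k c′) ])
  branchOut   c c′ = at (branchIx c) (λ k → [ not (isBranch k c′) ])
  branchPairs c c′ = at (branchIx c) (λ k → at (branchIx c′) (λ l → [ toℕ k <ᵇ toℕ l ]))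
  core        c c′ = [ isCore c ∧ isCore c′ ]
  lhs c c′ = hubOut c c′ + spokeOut c c′ + (branchPairs c c′ + branchPairs c c′)
  rhs c c′ = branchOut c c′ + core c c′

  -- on each pair of parts the symmetrised weights compare: an edge inside
  -- the core counts twice on both sides, an edge leaving a branch (to the
  -- core or to another branch) equally often on both sides
  balance : ∀ c c′ → lhs c c′ + lhs c′ c ≤ rhs c c′ + rhs c′ c
  balance hub        hub        = evaluated
  balance hub        (spoke l)  = evaluated
  balance hub        (branch l) = evaluated
  balance (spoke k)  hub        = evaluated
  balance (spoke k)  (spoke l)  = +-mono-≤ (at-most-1 (eqB k l)) (at-most-1 (eqB l k))
    where at-most-1 : ∀ t → [ not t ] + 0 ≤ 1
          at-most-1 t = ≤-trans (≤-reflexive (+-identityʳ _)) (ind-≤1 (not t))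
  balance (spoke k)  (branch l) = evaluated
  balance (branch k) hub        = evaluated
  balance (branch k) (spoke l)  = evaluated
  balance (branch k) (branch l) with <-cmp k l
  ... | tri< k<l k≢l _ rewrite <ᵇ-true k<l | <ᵇ-false (<⇒≯ k<l) | eqB-false k≢l | eqB-false (≢-sym k≢l) = evaluated
  ... | tri≈ k≮l refl _ rewrite <ᵇ-false k≮l | eqB-refl k = evaluated
  ... | tri> _ k≢l l<k rewrite <ᵇ-true l<k | <ᵇ-false (<⇒≯ l<k) | eqB-false k≢l | eqB-false (≢-sym k≢l) = evaluated

  W-hub W-spoke W-branch W-pairs W-core : Fin n → Fin n → ℕ
  W-hub    x y = hubOut (partOf x) (partOf y)
  W-spoke  x y = spokeOut (partOf x) (partOf y)
  W-branch x y = branchOut (partOf x) (partOf y)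
  W-pairs  x y = branchPairs (partOf x) (partOf y)
  W-core   x y = core (partOf x) (partOf y)

  count-hub : adjSum W-hub ≡ deg G a
  count-hub = sym (d-via hub-vertex)

  count-spokes : adjSum W-spoke ≡ sumF (λ i → deg G (b i))
  count-spokes = begin
    adjSum W-spoke
      ≡⟨ adjSum-cong (λ x y → at-indicator (spokeIx (partOf x)) (λ k → not (isSpoke k (partOf y)))) ⟩
    adjSum (λ x y → sumF (λ i → out i x y))  ≡⟨ adjSum-sum out ⟩
    sumF (λ i → adjSum (out i))              ≡⟨ sumF-cong (λ i → sym (d-via (spoke-vertex i))) ⟩
    sumF (λ i → deg G (b i))                 ∎
    where
    open ≡-Reasoning
    out : Fin r → Fin n → Fin n → ℕ
    out i x y = [ isSpoke i (partOf x) ∧ not (isSpoke i (partOf y)) ]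

  count-branches : adjSum W-branch ≡ sumF (λ i → d G (D i))
  count-branches = begin
    adjSum W-branch
      ≡⟨ adjSum-cong (λ x y → at-indicator (branchIx (partOf x)) (λ k → not (isBranch k (partOf y)))) ⟩
    adjSum (λ x y → sumF (λ i → out i x y))  ≡⟨ adjSum-sum out ⟩
    sumF (λ i → adjSum (out i))              ≡⟨ sumF-cong (λ i → sym (d-via (branch-vertex i))) ⟩
    sumF (λ i → d G (D i))                   ∎
    where
    open ≡-Reasoning
    out : Fin r → Fin n → Fin n → ℕ
    out i x y = [ isBranch i (partOf x) ∧ not (isBranch i (partOf y)) ]

  count-pairs : adjSum W-pairs ≡ pairwiseEdges G D
  count-pairs = begin
    adjSum W-pairs                                        ≡⟨ adjSum-cong pair-sum ⟩
    adjSum (λ x y → sumF (λ i → sumF (λ j → w i j x y)))  ≡⟨ adjSum-sum (λ i x y → sumF (λ j → w i j x y)) ⟩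
    sumF (λ i → adjSum (λ x y → sumF (λ j → w i j x y)))  ≡⟨ sumF-cong (λ i → adjSum-sum (w i)) ⟩
    sumF (λ i → sumF (λ j → adjSum (w i j)))              ≡⟨ sumF-cong (λ i → sumF-cong (λ j → pair-count i j)) ⟩
    pairwiseEdges G D                                     ∎
    where
    open ≡-Reasoning
    w : Fin r → Fin r → Fin n → Fin n → ℕ
    w i j x y = if toℕ i <ᵇ toℕ j then [ D i x ∧ D j y ] else 0
    pair-count : ∀ i j → adjSum (w i j) ≡ (if toℕ i <ᵇ toℕ j then dd G (D i) (D j) else 0)
    pair-count i j = trans (sym (adjSum-if (toℕ i <ᵇ toℕ j) (λ x y → [ D i x ∧ D j y ])))
                           (cong (λ t → if toℕ i <ᵇ toℕ j then t else 0) (sym (dd-adjSum (D i) (D j))))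
    pair-sum : ∀ x y → W-pairs x y ≡ sumF (λ i → sumF (λ j → w i j x y))
    pair-sum x y = trans (at-pairs (branchIx (partOf x)) (branchIx (partOf y)) (λ k l → toℕ k <ᵇ toℕ l))
      (sumF-cong (λ i → sumF-cong (λ j → cong₂ (λ p q → if toℕ i <ᵇ toℕ j then [ p ∧ q ] else 0)
                                                (sym (branch-vertex i x)) (sym (branch-vertex j y)))))

  core-size : card (λ v → isCore (partOf v)) ≡ suc r
  core-size = begin
    sumF (λ v → [ isCore (partOf v) ])                          ≡⟨ sumF-cong core-split ⟩
    sumF (λ v → [ eqB a v ] + sumF (λ i → [ eqB (b i) v ]))
      ≡⟨ sumF-+ (λ v → [ eqB a v ]) (λ v → sumF (λ i → [ eqB (b i) v ])) ⟩
    sumF (λ v → [ eqB a v ]) + sumF (λ v → sumF (λ i → [ eqB (b i) v ]))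
      ≡⟨ cong₂ _+_ (count-point a) (sumF-comm (λ v i → [ eqB (b i) v ])) ⟩
    1 + sumF (λ i → sumF (λ v → [ eqB (b i) v ]))
      ≡⟨ cong suc (trans (sumF-cong (λ i → count-point (b i))) (sumF-ones r)) ⟩
    suc r                                                       ∎
    where
    open ≡-Reasoning
    core-parts : ∀ c → [ isCore c ] ≡ [ isHub c ] + at (spokeIx c) (λ _ → 1)
    core-parts hub        = refl
    core-parts (spoke i)  = refl
    core-parts (branch i) = refl
    core-split : ∀ v → [ isCore (partOf v) ] ≡ [ eqB a v ] + sumF (λ i → [ eqB (b i) v ])
    core-split v = trans (core-parts (partOf v))
      (cong₂ _+_ (cong [_] (sym (hub-vertex v)))
                 (trans (at-sum (spokeIx (partOf v)) (λ _ → 1)) (sumF-cong (λ i → cong [_] (sym (spoke-vertex i v))))))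

  count-core : adjSum W-core ≤ suc r * r
  count-core = inner-pairs (λ v → isCore (partOf v)) r core-size

  star-count : deg G a + sumF (λ i → deg G (b i)) + 2 * pairwiseEdges G D ≤ sumF (λ i → d G (D i)) + suc r * r
  star-count = begin
    deg G a + sumF (λ i → deg G (b i)) + 2 * pairwiseEdges G D
                                                 ≡⟨ sym (trans (adjSum-shape W-hub W-spoke W-pairs)
                                                               (cong₂ _+_ (cong₂ _+_ count-hub count-spokes) (cong (2 *_) count-pairs))) ⟩
    adjSum (λ x y → lhs (partOf x) (partOf y))   ≤⟨ double-counting _ _ (λ x y → balance (partOf x) (partOf y)) ⟩
    adjSum (λ x y → rhs (partOf x) (partOf y))   ≡⟨ adjSum-+ W-branch W-core ⟩
    adjSum W-branch + adjSum W-core              ≤⟨ +-mono-≤ (≤-reflexive count-branches) count-core ⟩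
    sumF (λ i → d G (D i)) + suc r * r           ∎
    where open ≤-Reasoning

-- Four parts. For a partition V = P ⊔ Q ⊔ X ⊔ Y, numbered by quarters q₀ … q₃,
--   d(P) + d(Q) + 2 e(X,Y) ≤ d(X) + d(Y) + 2 e(P,Q).
q₀ q₁ q₂ q₃ : Fin 4
q₀ = zero
q₁ = suc zero
q₂ = suc (suc zero)
q₃ = suc (suc (suc zero))

in-q₂ : ∀ c → eqB c q₂ ≡ true → (eqB c q₀ ∨ eqB c q₁) ≡ false
in-q₂ c p with eqB-true p
... | refl = refl

in-q₃ : ∀ c → eqB c q₃ ≡ true → (eqB c q₀ ∨ eqB c q₁) ≡ false × eqB c q₂ ≡ false
in-q₃ c p with eqB-true p
... | refl = refl , refl

rest-in-q₃ : ∀ c → (eqB c q₀ ∨ eqB c q₁) ≡ false → eqB c q₂ ≡ false → eqB c q₃ ≡ true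
rest-in-q₃ zero                   ()
rest-in-q₃ (suc zero)             ()
rest-in-q₃ (suc (suc zero))       _ ()
rest-in-q₃ (suc (suc (suc zero))) _ _ = refl

leave : Fin 4 → Fin 4 → Fin 4 → ℕ
leave k c c′ = [ eqB c k ∧ not (eqB c′ k) ]

between : Fin 4 → Fin 4 → Fin 4 → Fin 4 → ℕ
between k l c c′ = [ eqB c k ∧ eqB c′ l ]

four-lhs four-rhs : Fin 4 → Fin 4 → ℕ
four-lhs c c′ = leave q₀ c c′ + leave q₁ c c′ + (between q₂ q₃ c c′ + between q₂ q₃ c c′)
four-rhs c c′ = leave q₂ c c′ + leave q₃ c c′ + (between q₀ q₁ c c′ + between q₀ q₁ c c′)

four-balance : ∀ c c′ → four-lhs c c′ + four-lhs c′ c ≤ four-rhs c c′ + four-rhs c′ c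
four-balance = from-yes (all? λ c → all? λ c′ → four-lhs c c′ + four-lhs c′ c ≤? four-rhs c c′ + four-rhs c′ c)

four-parts : (G : Graph) (quarter : Fin (Graph.n G) → Fin 4) (P Q X Y : Subset (Graph.n G)) →
  (∀ v → P v ≡ eqB (quarter v) q₀) → (∀ v → Q v ≡ eqB (quarter v) q₁) →
  (∀ v → X v ≡ eqB (quarter v) q₂) → (∀ v → Y v ≡ eqB (quarter v) q₃) →
  d G P + d G Q + 2 * dd G X Y ≤ d G X + d G Y + 2 * dd G P Q
four-parts G quarter P Q X Y P-q Q-q X-q Y-q = begin
  d G P + d G Q + 2 * dd G X Y
    ≡⟨ cong₂ _+_ (cong₂ _+_ (d-via P-q) (d-via Q-q)) (cong (2 *_) (dd-via X-q Y-q)) ⟩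
  adjSum (on (leave q₀)) + adjSum (on (leave q₁)) + 2 * adjSum (on (between q₂ q₃))
    ≡⟨ sym (adjSum-shape (on (leave q₀)) (on (leave q₁)) (on (between q₂ q₃))) ⟩
  adjSum (on four-lhs)                               ≤⟨ double-counting _ _ (λ x y → four-balance (quarter x) (quarter y)) ⟩
  adjSum (on four-rhs)                               ≡⟨ adjSum-shape (on (leave q₂)) (on (leave q₃)) (on (between q₀ q₁)) ⟩
  adjSum (on (leave q₂)) + adjSum (on (leave q₃)) + 2 * adjSum (on (between q₀ q₁))
    ≡⟨ sym (cong₂ _+_ (cong₂ _+_ (d-via X-q) (d-via Y-q)) (cong (2 *_) (dd-via P-q Q-q))) ⟩
  d G X + d G Y + 2 * dd G P Q                       ∎
  where
  open ≤-Reasoning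
  open Counting G
  on : (Fin 4 → Fin 4 → ℕ) → Fin (Graph.n G) → Fin (Graph.n G) → ℕ
  on w x y = w (quarter x) (quarter y)

module LocalConnectivity (G : Graph) where

  singleton-separates : ∀ {v w} → v ≢ w → Separates G (eqB v) v w
  singleton-separates {v} v≢w same = false≢true (trans (sym (eqB-false v≢w)) (trans (sym same) (eqB-refl v)))

  separates-via : ∀ X {v w} u → Separates G X v w → Separates G X v u ⊎ Separates G X u w
  separates-via X {v} {w} u sep with X u Bool.≟ X w
  ... | yes same = inj₁ (λ vu → sep (trans vu same))
  ... | no diff  = inj₂ diff

  local≤deg : ∀ {v w k} → v ≢ w → IsLocalEdgeConn G v w k → k ≤ deg G v
  local≤deg {v} v≢w (_ , minimal) = minimal (eqB v) (singleton-separates v≢w)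

  -- the smaller of the two singleton cuts realises min(d(v), d(w)), so a
  -- lower bound on separating cuts makes the pair pendant
  pendant-by-bound : ∀ {v w} → v ≢ w → (∀ X → Separates G X v w → deg G v ⊓ deg G w ≤ d G X) → Pendant G v w
  pendant-by-bound {v} {w} v≢w bound = v≢w , smaller-singleton , bound
    where
    smaller-singleton : ∃[ X ] (Separates G X v w × d G X ≡ deg G v ⊓ deg G w)
    smaller-singleton with deg G v ≤? deg G w
    ... | yes v≤w = eqB v , singleton-separates v≢w , sym (m≤n⇒m⊓n≡m v≤w)
    ... | no  v≰w = eqB w , (λ e → singleton-separates (≢-sym v≢w) (sym e)) , sym (m≥n⇒m⊓n≡n (≰⇒≥ v≰w))

-- In a pendant tree the cut c(XY) of an edge towards a singleton block Y = {y}
-- is smaller than d(y): otherwise every pair (a, y), a ∈ X, would be pendant,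
-- contradicting property (ii).
module PendantCut {G : Graph} {m : ℕ} {β : Fin (Graph.n G) → Fin m} {E : Fin m → Fin m → Bool}
    (PT : IsPendantTree G β E) where
  open IsPendantTree PT
  open IsTree tree using (irreflT)
  open LocalConnectivity G

  -- if d(y) ≤ c(XY) then every a ∈ X forms a pendant pair with y: a cut
  -- separating a from y separates y from the vertex a* of X realising
  -- c(XY) = λ(a*, y), or a from a*, a pendant pair of X with d(a*) ≥ d(y)
  pendant-across : ∀ {X Y} → E X Y ≡ true → ∀ {y} → β y ≡ Y → (∀ v → β v ≡ Y → v ≡ y) →
                   deg G y ≤ c G β E X Y → ∀ {a} → β a ≡ X → Pendant G a y
  pendant-across {X} {Y} XY {y} y∈Y Y-single y≤cut {a} a∈X with cutRealised X Y XY
  ... | a* , b* , a*∈X , b*∈Y , λ-a*b* = pendant-by-bound (in-X≢y a∈X) bound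
    where
    λ* : IsLocalEdgeConn G a* y (c G β E X Y)
    λ* = subst (λ t → IsLocalEdgeConn G a* t (c G β E X Y)) (Y-single b* b*∈Y) λ-a*b*
    in-X≢y : ∀ {u} → β u ≡ X → u ≢ y
    in-X≢y u∈X refl = false≢true (trans (sym (irreflT X))
                        (subst (λ Z → E X Z ≡ true) (trans (sym y∈Y) u∈X) XY))
    y≤a* : deg G y ≤ deg G a*
    y≤a* = ≤-trans y≤cut (local≤deg (in-X≢y a*∈X) λ*)
    bound : ∀ Z → Separates G Z a y → deg G a ⊓ deg G y ≤ d G Z
    bound Z sep with separates-via Z a* sep
    ... | inj₂ sep* = ≤-trans (m⊓n≤n _ _) (≤-trans y≤cut (proj₂ λ* Z sep*))
    ... | inj₁ sepa with a ≟ a*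
    ...   | yes refl = ⊥-elim (sepa refl)
    ...   | no a≢a*  = ≤-trans (⊓-monoʳ-≤ (deg G a) y≤a*)
                        (proj₂ (proj₂ (pendantInBlock a a* a≢a* (trans a∈X (sym a*∈X)))) Z sepa)

  cut-below-singleton : ∀ {X Y} → E X Y ≡ true → ∀ {y} → β y ≡ Y → (∀ v → β v ≡ Y → v ≡ y) →
                        c G β E X Y < deg G y
  cut-below-singleton {X} {Y} XY {y} y∈Y Y-single with c G β E X Y <? deg G y
  ... | yes lt = lt
  ... | no ¬lt =
    let (a , b , a∈X , b∈Y , non-pendant) = nonPendantAcross X Y XY in
    ⊥-elim (non-pendant (subst (Pendant G a) (sym (Y-single b b∈Y))
                               (pendant-across XY y∈Y Y-single (≮⇒≥ ¬lt) a∈X)))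

cancel-bound : ∀ {x y s t p q} → x + t + y ≤ s + (p + q) → s + p ≤ t → x + y ≤ q
cancel-bound {x} {y} {s} {t} {p} {q} upper lower = +-cancelˡ-≤ (s + p) (x + y) q (begin
  s + p + (x + y)   ≡⟨ +-comm (s + p) (x + y) ⟩
  x + y + (s + p)   ≡⟨ +-assoc x y (s + p) ⟩
  x + (y + (s + p)) ≡⟨ cong (x +_) (+-comm y (s + p)) ⟩
  x + (s + p + y)   ≡⟨ sym (+-assoc x (s + p) y) ⟩
  x + (s + p) + y   ≤⟨ +-monoˡ-≤ y (+-monoʳ-≤ x lower) ⟩
  x + t + y         ≤⟨ upper ⟩
  s + (p + q)       ≡⟨ sym (+-assoc s p q) ⟩
  s + p + q         ∎)
  where open ≤-Reasoning

squeeze : ∀ {p q x y s t} → p + q + 2 * s ≤ x + y + 2 * t → x < q → y < p → t ≤ 1 → s ≡ 0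
squeeze {p} {q} {x} {y} {s} {t} upper x<q y<p t≤1 =
  n≤0⇒n≡0 (≤-trans (m≤m+n s (s + 0)) (+-cancelˡ-≤ (p + q) (2 * s) 0 (begin
    p + q + 2 * s   ≤⟨ upper ⟩
    x + y + 2 * t   ≤⟨ +-monoʳ-≤ (x + y) (*-monoʳ-≤ 2 t≤1) ⟩
    x + y + 2       ≡⟨ trans (+-comm (x + y) 2) (cong suc (sym (+-suc x y))) ⟩
    suc x + suc y   ≤⟨ +-mono-≤ x<q y<p ⟩
    q + p           ≡⟨ +-comm q p ⟩
    p + q           ≡⟨ sym (+-identityʳ (p + q)) ⟩
    p + q + 0       ∎)))
  where open ≤-Reasoning

other-element : ∀ {m} → 1 < m → (A : Fin m) → ∃[ Z ] Z ≢ A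
other-element {suc (suc _)} _ zero    = suc zero , λ ()
other-element {suc (suc _)} _ (suc _) = zero , λ ()
other-element {suc zero} (s≤s ()) zero

singleton-test : ∀ {n m} {β : Fin n → Fin m} {u X} → β u ≡ X → (∀ v → β v ≡ X → v ≡ u) →
                 ∀ v → eqB u v ≡ eqB X (β v)
singleton-test {β = β} {u} {X} u∈X only-u v with u ≟ v
... | yes refl = sym (trans (cong (eqB X) u∈X) (eqB-refl X))
... | no u≢v   = sym (eqB-false (λ X≡βv → u≢v (sym (only-u v (sym X≡βv)))))

record StarConfiguration (G : Graph) {m : ℕ} (β : Fin (Graph.n G) → Fin m)
                         (E : Fin m → Fin m → Bool) (r : ℕ) : Set where
  constructor star
  field
    A           : Fin m
    a           : Fin (Graph.n G)
    a∈A         : β a ≡ A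
    A-singleton : ∀ v → β v ≡ A → v ≡ a
    B           : Fin r → Fin m
    B-inj       : Injective _≡_ _≡_ B
    A–B         : ∀ i → E A (B i) ≡ true
    A-nbrs      : ∀ X → E A X ≡ true → ∃[ i ] B i ≡ X
    B-deg2      : ∀ i → degB E (B i) ≡ 2
    b           : Fin r → Fin (Graph.n G)
    b∈B         : ∀ i → β (b i) ≡ B i
    B-singleton : ∀ i v → β v ≡ B i → v ≡ b i
    B′          : Fin r → Fin m
    B–B′        : ∀ i → E (B i) (B′ i) ≡ true
    B′≢A        : ∀ i → B′ i ≢ A

module Star {G : Graph} {m : ℕ} {β : Fin (Graph.n G) → Fin m} {E : Fin m → Fin m → Bool}
    (PT : IsPendantTree G β E) {r : ℕ} (S : StarConfiguration G β E r) where
  open Graph G using (n)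
  open IsPendantTree PT using (tree)
  open IsTree tree using (bridges)
  open StarConfiguration S
  open StarBlocks tree A B B-inj A–B A-nbrs B-deg2 B′ B–B′ B′≢A public
  open PendantCut PT

  partOf : Fin n → Part r
  partOf v = part (place (β v))

  D side : Fin r → Subset n
  D i    = C G β E (B′ i) (B i)
  side i = C G β E (B i) A

  hub-vertex : ∀ v → eqB a v ≡ isHub (partOf v)
  hub-vertex v = trans (singleton-test a∈A A-singleton v) (hub-block (place (β v)))

  spoke-vertex : ∀ i v → eqB (b i) v ≡ isSpoke i (partOf v)
  spoke-vertex i v = trans (singleton-test (b∈B i) (B-singleton i) v) (spoke-block i (place (β v)))

  branch-vertex : ∀ i v → D i v ≡ isBranch i (partOf v)
  branch-vertex i v = branch-block i (place (β v))

  side-vertex : ∀ i v → side i v ≡ isSpoke i (partOf v) ∨ isBranch i (partOf v)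
  side-vertex i v = side-block i (place (β v))

  open StarCount G partOf a b D hub-vertex spoke-vertex branch-vertex using (star-count)

  branch-cut : ∀ i → d G (D i) < deg G (b i)
  branch-cut i = cut-below-singleton (B′–B i) (b∈B i) (B-singleton i)

  side-cut : ∀ i → d G (side i) < deg G a
  side-cut i = cut-below-singleton (B–A i) a∈A A-singleton

  degree-bound : deg G a + 2 * gamma G β E B B′ ≤ r * r
  degree-bound = cancel-bound {x = deg G a} {s = sumF (λ i → d G (D i))} {p = r} star-count branches-below-spokes
    where
    open ≤-Reasoning
    branches-below-spokes : sumF (λ i → d G (D i)) + r ≤ sumF (λ i → deg G (b i))
    branches-below-spokes = begin
      sumF (λ i → d G (D i)) + r                    ≡⟨ cong (sumF (λ i → d G (D i)) +_) (sym (sumF-ones r)) ⟩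
      sumF (λ i → d G (D i)) + sumF {r} (λ _ → 1)   ≡⟨ sym (sumF-+ (λ i → d G (D i)) (λ _ → 1)) ⟩
      sumF (λ i → d G (D i) + 1)
        ≤⟨ sumF-mono (λ i → subst (_≤ deg G (b i)) (+-comm 1 (d G (D i))) (branch-cut i)) ⟩
      sumF (λ i → deg G (b i))                      ∎

  min-degree-bound : ∀ k → IsMinDegree G k → k ≤ r * r
  min-degree-bound k (_ , k≤deg) = ≤-trans (k≤deg a) (≤-trans (m≤m+n _ _) degree-bound)

  side-proper : ∀ i → Proper G (side i)
  side-proper i = (b i , subst (λ Z → reach (T-side i) (B i) Z ≡ true) (sym (b∈B i)) (walk⇒reach {E = T-side i} here))
                , (a , subst (λ Z → reach (T-side i) (B i) Z ≡ false) (sym a∈A) (bridges (B i) A (B–A i)))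

  edge-connectivity-bound : Fin r → ∀ k → IsEdgeConn G k → k < r * r
  edge-connectivity-bound i k (_ , k≤cut) =
    ≤-<-trans (k≤cut (side i) (side-proper i)) (<-≤-trans (side-cut i) (≤-trans (m≤m+n _ _) degree-bound))

  some-spoke : 1 < m → Fin r
  some-spoke 1<m with other-element 1<m A
  ... | Z , Z≢A with place Z
  ...   | at-hub Z≡A    = ⊥-elim (Z≢A Z≡A)
  ...   | at-spoke i _  = i
  ...   | in-branch i _ = i

-- For r = 2 the hub and the first spoke separate the first branch from the
-- side of the second spoke: the four parts {a}, {b_1}, D_1, S_2 satisfy
-- d(a) + d(b_1) + 2 e(D_1, S_2) ≤ d(D_1) + d(S_2) + 2 e(a, b_1), while
-- d(D_1) < d(b_1), d(S_2) < d(a) and e(a, b_1) ≤ 1.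
module TwoSpokes {G : Graph} {m : ℕ} {β : Fin (Graph.n G) → Fin m} {E : Fin m → Fin m → Bool}
    (PT : IsPendantTree G β E) (S : StarConfiguration G β E 2) where
  open Graph G using (n; adj)
  open IsPendantTree PT using (blocksNonempty)
  open StarConfiguration S
  open Star PT S
  open Counting G using (no-edge; dd-singletons)

  i₁ i₂ : Fin 2
  i₁ = zero
  i₂ = suc zero

  quarterOf : Part 2 → Fin 4
  quarterOf hub              = q₀
  quarterOf (spoke zero)     = q₁
  quarterOf (branch zero)    = q₂
  quarterOf (spoke (suc zero))  = q₃
  quarterOf (branch (suc zero)) = q₃

  quarters : ∀ c → (isHub c ≡ eqB (quarterOf c) q₀) × (isSpoke i₁ c ≡ eqB (quarterOf c) q₁)
                 × (isBranch i₁ c ≡ eqB (quarterOf c) q₂) × ((isSpoke i₂ c ∨ isBranch i₂ c) ≡ eqB (quarterOf c) q₃)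
  quarters hub                 = refl , refl , refl , refl
  quarters (spoke zero)        = refl , refl , refl , refl
  quarters (spoke (suc zero))  = refl , refl , refl , refl
  quarters (branch zero)       = refl , refl , refl , refl
  quarters (branch (suc zero)) = refl , refl , refl , refl

  quarter : Fin n → Fin 4
  quarter v = quarterOf (partOf v)

  P-q : ∀ v → eqB a v ≡ eqB (quarter v) q₀
  P-q v = trans (hub-vertex v) (proj₁ (quarters (partOf v)))
  Q-q : ∀ v → eqB (b i₁) v ≡ eqB (quarter v) q₁
  Q-q v = trans (spoke-vertex i₁ v) (proj₁ (proj₂ (quarters (partOf v))))
  X-q : ∀ v → D i₁ v ≡ eqB (quarter v) q₂
  X-q v = trans (branch-vertex i₁ v) (proj₁ (proj₂ (proj₂ (quarters (partOf v)))))
  Y-q : ∀ v → side i₂ v ≡ eqB (quarter v) q₃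
  Y-q v = trans (side-vertex i₂ v) (proj₂ (proj₂ (proj₂ (quarters (partOf v)))))

  D₁-S₂-free : dd G (D i₁) (side i₂) ≡ 0
  D₁-S₂-free = squeeze (four-parts G quarter (eqB a) (eqB (b i₁)) (D i₁) (side i₂) P-q Q-q X-q Y-q)
                       (branch-cut i₁) (side-cut i₂)
                       (≤-trans (≤-reflexive (dd-singletons a (b i₁))) (ind-≤1 (adj a (b i₁))))

  separator : Subset n
  separator v = eqB a v ∨ eqB (b i₁) v

  separator-q : ∀ v → separator v ≡ eqB (quarter v) q₀ ∨ eqB (quarter v) q₁
  separator-q v = cong₂ _∨_ (P-q v) (Q-q v)

  separator-size : card separator ≤ 2
  separator-size = begin
    sumF (λ v → [ eqB a v ∨ eqB (b i₁) v ])               ≤⟨ sumF-mono (λ v → ind-∨ (eqB a v) (eqB (b i₁) v)) ⟩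
    sumF (λ v → [ eqB a v ] + [ eqB (b i₁) v ])           ≡⟨ sumF-+ (λ v → [ eqB a v ]) (λ v → [ eqB (b i₁) v ]) ⟩
    sumF (λ v → [ eqB a v ]) + sumF (λ v → [ eqB (b i₁) v ]) ≡⟨ cong₂ _+_ (count-point a) (count-point (b i₁)) ⟩
    2                                                     ∎
    where open ≤-Reasoning

  separator-cut : IsVertexCut G separator
  separator-cut = inj₂ (D i₁ , outside-separator , D₁-nonempty , b₂-beyond , D₁-closed)
    where
    outside-separator : ∀ v → D i₁ v ≡ true → separator v ≡ false
    outside-separator v p = trans (separator-q v) (in-q₂ (quarter v) (trans (sym (X-q v)) p))
    D₁-nonempty : ∃[ v ] D i₁ v ≡ true
    D₁-nonempty with blocksNonempty (B′ i₁)
    ... | v , v∈B′ = v , subst (λ Z → reach (T-branch i₁) (B′ i₁) Z ≡ true) (sym v∈B′)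
                                (walk⇒reach {E = T-branch i₁} here)
    b₂-beyond : ∃[ w ] (separator w ≡ false × D i₁ w ≡ false)
    b₂-beyond = b i₂ , trans (separator-q (b i₂)) (proj₁ in-S₂) , trans (X-q (b i₂)) (proj₂ in-S₂)
      where
      b₂∈S₂ : side i₂ (b i₂) ≡ true
      b₂∈S₂ = subst (λ Z → reach (T-side i₂) (B i₂) Z ≡ true) (sym (b∈B i₂)) (walk⇒reach {E = T-side i₂} here)
      in-S₂ : (eqB (quarter (b i₂)) q₀ ∨ eqB (quarter (b i₂)) q₁) ≡ false × eqB (quarter (b i₂)) q₂ ≡ false
      in-S₂ = in-q₃ (quarter (b i₂)) (trans (sym (Y-q (b i₂))) b₂∈S₂)
    D₁-closed : ∀ x y → D i₁ x ≡ true → separator y ≡ false → D i₁ y ≡ false → adj x y ≡ false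
    D₁-closed x y x∈D₁ y∉sep y∉D₁ = no-edge (D i₁) (side i₂) D₁-S₂-free x∈D₁
      (trans (Y-q y) (rest-in-q₃ (quarter y) (trans (sym (separator-q y)) y∉sep) (trans (sym (X-q y)) y∉D₁)))

  vertex-connectivity-bound : ∀ k → IsVertexConn G k → k ≤ 2
  vertex-connectivity-bound k (_ , minimal) = ≤-trans (minimal separator separator-cut) separator-size

lemma14 : (G : Graph) (m : ℕ) (β : Fin (Graph.n G) → Fin m) (E : Fin m → Fin m → Bool) →
    IsPendantTree G β E → 1 < m →
    (A : Fin m) (vA : Fin (Graph.n G)) → β vA ≡ A → (∀ v → β v ≡ A → v ≡ vA) →
    (r : ℕ) → degB E A ≡ r →
    (B : Fin r → Fin m) → Injective _≡_ _≡_ B →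
    (∀ i → E A (B i) ≡ true) → (∀ X → E A X ≡ true → ∃[ i ] B i ≡ X) →
    (∀ i → degB E (B i) ≡ 2) →
    (b : Fin r → Fin (Graph.n G)) → (∀ i → β (b i) ≡ B i) →
    (∀ i v → β v ≡ B i → v ≡ b i) →
    (B' : Fin r → Fin m) → (∀ i → E (B i) (B' i) ≡ true) → (∀ i → B' i ≢ A) →
    (deg G vA + 2 * gamma G β E B B' ≤ r * r)
    × (∀ k → IsMinDegree G k → k ≤ r * r)
    × (∀ k → IsEdgeConn G k → k < r * r)
    × (r ≡ 2 → ∀ k → IsVertexConn G k → k ≤ 2)
lemma14 G m β E PT 1<m A vA vA∈A A-single r _ B B-inj A–B A-nbrs B-deg2 b b∈B B-single B′ B–B′ B′≢A =
    degree-bound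
  , min-degree-bound
  , edge-connectivity-bound (some-spoke 1<m)
  , λ { refl → TwoSpokes.vertex-connectivity-bound PT S }
  where
  S : StarConfiguration G β E r
  S = star A vA vA∈A A-single B B-inj A–B A-nbrs B-deg2 b b∈B B-single B′ B–B′ B′≢A
  open Star PT S using (degree-bound; min-degree-bound; edge-connectivity-bound; some-spoke)
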